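{- Let $q\ge 2$ be a prime power and let $H_q$ be the graph defined in the context. Then $H_q$ is a $q$-regular bipartite graph of girth $8$ and order $2q^3$.
   Context: Let $\mathbb{F}_q$ be the finite field with $q$ elements. $H_q=H_q[U_0,U_1]$ is the bipartite graph with partite sets $U_r=\{(a,b,c)_r : a,b,c\in\mathbb{F}_q\}$, $r=0,1$, in which for all $a,b,c\in\mathbb{F}_q$ the neighbourhood of $(a,b,c)_1$ is $\{(x,\,ax+b,\,a^2x+c)_0 : x\in\mathbb{F}_q\}$. The girth is the length of a shortest cycle. -}

module Defs where

open import Level using (0ℓ)
open import Data.Nat using (ℕ; zero; suc; _≤_; _<_; _^_)
open import Data.Nat.Primality using (Prime)
open import Data.Fin using (Fin; zero; suc; fromℕ; inject₁)
open import Data.Product using (Σ; ∃; _×_; _,_)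
open import Data.Empty using (⊥)
open import Data.Unit using (⊤)
open import Data.Bool using (Bool; true; false)
open import Relation.Nullary using (¬_)
open import Relation.Binary.PropositionalEquality using (_≡_; _≢_)
open import Function.Bundles using (_↔_)
open import Function.Definitions using (Injective)
open import Algebra.Structures using (IsCommutativeRing)

IsPrimePower : ℕ → Set
IsPrimePower q = Σ ℕ λ p → Σ ℕ λ k → Prime p × 1 ≤ k × q ≡ p ^ k

record Field : Set₁ where
  infixl 6 _+_
  infixl 7 _*_
  field
    Carrier : Set
    _+_ _*_ : Carrier → Carrier → Carrier
    -_ : Carrier → Carrier
    0# 1# : Carrier
    isCommutativeRing : IsCommutativeRing _≡_ _+_ _*_ -_ 0# 1#
    0≢1 : 0# ≢ 1#
    inverse : ∀ x → x ≢ 0# → Σ Carrier λ y → x * y ≡ 1#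

record FiniteField (q : ℕ) : Set₁ where
  field
    field′ : Field
  open Field field′ public
  field
    card : Fin q ↔ Carrier

record Graph : Set₁ where
  field
    V   : Set
    Adj : V → V → Set

module _ (G : Graph) where
  open Graph G

  HasOrder : ℕ → Set
  HasOrder n = Fin n ↔ V

  IsRegular : ℕ → Set
  IsRegular k = ∀ v → Fin k ↔ (Σ V λ w → Adj v w)

  IsBipartiteWrt : (V → Bool) → Set
  IsBipartiteWrt side = ∀ v w → Adj v w → side v ≢ side w

  IsBipartite : Set
  IsBipartite = Σ (V → Bool) IsBipartiteWrt

  -- a cycle of length (suc m): distinct vertices v₀ … v_m with
  -- v_i ~ v_{i+1} and v_m ~ v₀
  record Cycle (m : ℕ) : Set where
    field
      vert      : Fin (suc m) → V
      distinct  : Injective _≡_ _≡_ vert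
      adjacent  : ∀ (i : Fin m) → Adj (vert (inject₁ i)) (vert (suc i))
      closing   : Adj (vert (fromℕ m)) (vert zero)

  HasCycleOfLength : ℕ → Set
  HasCycleOfLength zero    = ⊥
  HasCycleOfLength (suc m) = 3 ≤ suc m × Cycle m

  HasGirth : ℕ → Set
  HasGirth g = HasCycleOfLength g × (∀ n → n < g → ¬ HasCycleOfLength n)

module _ {q : ℕ} (F : FiniteField q) where
  open FiniteField F

  data HVertex : Set where
    vtx₀ : Carrier → Carrier → Carrier → HVertex
    vtx₁ : Carrier → Carrier → Carrier → HVertex

  HAdj : HVertex → HVertex → Set
  HAdj (vtx₁ a b c) (vtx₀ x y z) = (y ≡ a * x + b) × (z ≡ (a * a) * x + c)
  HAdj (vtx₀ x y z) (vtx₁ a b c) = (y ≡ a * x + b) × (z ≡ (a * a) * x + c)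
  HAdj (vtx₀ _ _ _) (vtx₀ _ _ _) = ⊥
  HAdj (vtx₁ _ _ _) (vtx₁ _ _ _) = ⊥

  Hq : Graph
  Hq = record { V = HVertex ; Adj = HAdj }

  part : HVertex → Bool
  part (vtx₀ _ _ _) = false
  part (vtx₁ _ _ _) = true

-- H_q is the incidence graph of the points (x, y, z) and the lines (a, b, c) of F³, a point lying on a
-- line when y = a x + b and z = a² x + c. Being bipartite, it has no odd cycles. Two points on two lines
-- give (a − a′)(x − x′) = 0, so there is no 4-cycle. A 6-cycle is a triangle of three lines with slopes
-- aᵢ meeting in points with abscissae xᵢ; going around it, the y- and the z-equations give
-- Σ (aᵢ − aᵢ₊₁) xᵢ = 0 and Σ (aᵢ² − aᵢ₊₁²) xᵢ = 0, whence (a₁ − a₂)(a₂ − a₃)(x₁ − x₂) = 0 and the triangle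
-- degenerates. An explicit 8-cycle shows that the girth is exactly 8. The neighbours of a line are
-- indexed by their abscissa and those of a point by their slope, whence q-regularity.
module Submission where

open import Defs
open import Level using (0ℓ)
open import Data.Nat as ℕ using (ℕ; zero; suc; _<_; _≤_; s≤s; z≤n)
open import Data.Nat.GeneralisedArithmetic using (fold)
open import Data.Fin using (Fin; zero; suc; toℕ; inject₁; fromℕ)
open import Data.Fin.Patterns using (0F; 1F; 2F; 3F; 4F; 5F; 6F; 7F)
open import Data.Fin.Properties using (toℕ-inject₁; toℕ-fromℕ; inj⇒≟; *↔×; 2↔Bool)
open import Data.Fin.Induction using (<-weakInduction)
open import Data.Bool using (Bool; true; false; not)
open import Data.Bool.Properties using (¬-not; not-involutive)
open import Data.Product using (Σ; _×_; _,_; proj₁; proj₂; swap; uncurry)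
import Data.Product.Properties as Product
open import Data.Product.Function.NonDependent.Propositional using (_×-↔_)
open import Data.Sum using (_⊎_; inj₁; inj₂; [_,_]′)
import Data.Sum
open import Data.Vec using (Vec; []; _∷_; uncons)
open import Data.Empty using (⊥)
open import Data.Maybe using (map)
open import Function using (_∘_)
open import Function.Bundles using (_↔_; mk↔ₛ′)
open import Function.Properties.Inverse using (↔-trans; ↔-sym; ↔⇒↣)
open import Algebra.Bundles using (CommutativeRing; RawRing)
open import Algebra.Solver.Ring.AlmostCommutativeRing using (fromCommutativeRing; _-Raw-AlmostCommutative⟶_)
open import Axiom.UniquenessOfIdentityProofs using (module Decidable⇒UIP)
open import Relation.Nullary using (¬_; does; yes; no)
open import Relation.Nullary.Decidable using (dec-true; dec-false)
open import Relation.Binary.Definitions using (DecidableEquality)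
open import Relation.Binary.Consequences using (dec⇒weaklyDec)
open import Relation.Binary.PropositionalEquality
  using (_≡_; _≢_; refl; sym; trans; cong; cong₂; ≢-sym; module ≡-Reasoning)

-- The solver of Algebra.Solver.Ring decides equality of coefficients by computation, so an abstract
-- ring cannot serve as its own coefficient ring; here the coefficients are integers.
module RingSolver {c ℓ} (R : CommutativeRing c ℓ) where
  open CommutativeRing R renaming (refl to ≈-refl; sym to ≈-sym; trans to ≈-trans)
  open import Algebra.Properties.Ring ring using (x[y-z]≈xy-xz; [y-z]x≈yx-zx)
  open import Algebra.Properties.AbelianGroup +-abelianGroup using (⁻¹-∙-comm; ⁻¹-anti-homo‿-)
  open import Algebra.Properties.Group +-group using (ε⁻¹≈ε)
  open import Algebra.Properties.CommutativeSemigroup +-commutativeSemigroup using (interchange)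
  open import Algebra.Properties.Semiring.Mult.TCOptimised semiring using (1+×; ×-homo-+; ×1-homo-*) renaming (_×_ to _·_)
  open import Relation.Binary.Reasoning.Setoid setoid

  [a-b]+[c-d]≈[a+c]-[b+d] : ∀ a b c d → (a - b) + (c - d) ≈ (a + c) - (b + d)
  [a-b]+[c-d]≈[a+c]-[b+d] a b c d = ≈-trans (interchange a (- b) c (- d)) (+-congˡ (⁻¹-∙-comm b d))

  [c+a]-[c+b]≈a-b : ∀ a b c → (c + a) - (c + b) ≈ a - b
  [c+a]-[c+b]≈a-b a b c = begin
    (c + a) - (c + b)   ≈⟨ [a-b]+[c-d]≈[a+c]-[b+d] c c a b ⟨
    (c - c) + (a - b)   ≈⟨ +-congʳ (-‿inverseʳ c) ⟩
    0# + (a - b)        ≈⟨ +-identityˡ (a - b) ⟩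
    a - b               ∎

  [a-b][c-d]≈[ac+bd]-[ad+bc] : ∀ a b c d → (a - b) * (c - d) ≈ (a * c + b * d) - (a * d + b * c)
  [a-b][c-d]≈[ac+bd]-[ad+bc] a b c d = begin
    (a - b) * (c - d)                    ≈⟨ [y-z]x≈yx-zx (c - d) a b ⟩
    a * (c - d) - b * (c - d)            ≈⟨ +-cong (x[y-z]≈xy-xz a c d) (-‿cong (x[y-z]≈xy-xz b c d)) ⟩
    (a * c - a * d) - (b * c - b * d)    ≈⟨ +-congˡ (⁻¹-anti-homo‿- (b * c) (b * d)) ⟩
    (a * c - a * d) + (b * d - b * c)    ≈⟨ [a-b]+[c-d]≈[a+c]-[b+d] (a * c) (a * d) (b * d) (b * c) ⟩
    (a * c + b * d) - (a * d + b * c)    ∎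

  -- The integer p − n is coded as (p , n); reduce cancels common successors, so that equal integers
  -- get equal codes and the solver may compare coefficients by syntactic equality.
  reduce : ℕ × ℕ → ℕ × ℕ
  reduce (suc p , suc n) = reduce (p , n)
  reduce d               = d

  differenceRing : RawRing 0ℓ 0ℓ
  differenceRing = record
    { Carrier = ℕ × ℕ
    ; _≈_     = _≡_
    ; _+_     = λ (p , n) (p′ , n′) → reduce (p ℕ.+ p′ , n ℕ.+ n′)
    ; _*_     = λ (p , n) (p′ , n′) → reduce (p ℕ.* p′ ℕ.+ n ℕ.* n′ , p ℕ.* n′ ℕ.+ n ℕ.* p′)
    ; -_      = swap
    ; 0#      = 0 , 0
    ; 1#      = 1 , 0
    }

  -- Chosen so that the constants 0 and 1 evaluate to 0# and 1# on the nose.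
  ⟦_⟧ : ℕ × ℕ → Carrier
  ⟦ p     , zero  ⟧ = p · 1#
  ⟦ zero  , suc n ⟧ = - (suc n · 1#)
  ⟦ suc p , suc n ⟧ = ⟦ p , n ⟧

  ⟦reduce⟧ : ∀ d → ⟦ reduce d ⟧ ≈ ⟦ d ⟧
  ⟦reduce⟧ (suc p , suc n) = ⟦reduce⟧ (p , n)
  ⟦reduce⟧ (zero  , _)     = ≈-refl
  ⟦reduce⟧ (suc _ , zero)  = ≈-refl

  ⟦⟧-difference : ∀ p n → ⟦ p , n ⟧ ≈ p · 1# - n · 1#
  ⟦⟧-difference p       zero    = ≈-sym (≈-trans (+-congˡ ε⁻¹≈ε) (+-identityʳ (p · 1#)))
  ⟦⟧-difference zero    (suc n) = ≈-sym (+-identityˡ (- (suc n · 1#)))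
  ⟦⟧-difference (suc p) (suc n) = begin
    ⟦ p , n ⟧                       ≈⟨ ⟦⟧-difference p n ⟩
    p · 1# - n · 1#                 ≈⟨ [c+a]-[c+b]≈a-b (p · 1#) (n · 1#) 1# ⟨
    (1# + p · 1#) - (1# + n · 1#)   ≈⟨ +-cong (1+× p 1#) (-‿cong (1+× n 1#)) ⟨
    suc p · 1# - suc n · 1#         ∎

  ⟦⟧-reduce-difference : ∀ p n → ⟦ reduce (p , n) ⟧ ≈ p · 1# - n · 1#
  ⟦⟧-reduce-difference p n = ≈-trans (⟦reduce⟧ (p , n)) (⟦⟧-difference p n)

  homomorphism : differenceRing -Raw-AlmostCommutative⟶ fromCommutativeRing R
  homomorphism = record
    { ⟦_⟧    = ⟦_⟧
    ; +-homo = λ (p , n) (p′ , n′) → begin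
        ⟦ reduce (p ℕ.+ p′ , n ℕ.+ n′) ⟧               ≈⟨ ⟦⟧-reduce-difference (p ℕ.+ p′) (n ℕ.+ n′) ⟩
        (p ℕ.+ p′) · 1# - (n ℕ.+ n′) · 1#            ≈⟨ +-cong (×-homo-+ 1# p p′) (-‿cong (×-homo-+ 1# n n′)) ⟩
        (p · 1# + p′ · 1#) - (n · 1# + n′ · 1#)      ≈⟨ [a-b]+[c-d]≈[a+c]-[b+d] _ _ _ _ ⟨
        (p · 1# - n · 1#) + (p′ · 1# - n′ · 1#)      ≈⟨ +-cong (⟦⟧-difference p n) (⟦⟧-difference p′ n′) ⟨
        ⟦ p , n ⟧ + ⟦ p′ , n′ ⟧                      ∎
    ; *-homo = λ (p , n) (p′ , n′) → begin
        ⟦ reduce (p ℕ.* p′ ℕ.+ n ℕ.* n′ , p ℕ.* n′ ℕ.+ n ℕ.* p′) ⟧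
          ≈⟨ ⟦⟧-reduce-difference (p ℕ.* p′ ℕ.+ n ℕ.* n′) (p ℕ.* n′ ℕ.+ n ℕ.* p′) ⟩
        (p ℕ.* p′ ℕ.+ n ℕ.* n′) · 1# - (p ℕ.* n′ ℕ.+ n ℕ.* p′) · 1#
          ≈⟨ +-cong (sum-of-products·1# p p′ n n′) (-‿cong (sum-of-products·1# p n′ n p′)) ⟩
        (p · 1# * p′ · 1# + n · 1# * n′ · 1#) - (p · 1# * n′ · 1# + n · 1# * p′ · 1#)
          ≈⟨ [a-b][c-d]≈[ac+bd]-[ad+bc] _ _ _ _ ⟨
        (p · 1# - n · 1#) * (p′ · 1# - n′ · 1#)
          ≈⟨ *-cong (⟦⟧-difference p n) (⟦⟧-difference p′ n′) ⟨
        ⟦ p , n ⟧ * ⟦ p′ , n′ ⟧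
          ∎
    ; -‿homo = λ (p , n) → begin
        ⟦ n , p ⟧           ≈⟨ ⟦⟧-difference n p ⟩
        n · 1# - p · 1#     ≈⟨ ⁻¹-anti-homo‿- (p · 1#) (n · 1#) ⟨
        - (p · 1# - n · 1#) ≈⟨ -‿cong (⟦⟧-difference p n) ⟨
        - ⟦ p , n ⟧         ∎
    ; 0-homo = ≈-refl
    ; 1-homo = ≈-refl
    }
    where
    sum-of-products·1# : ∀ a b c d → (a ℕ.* b ℕ.+ c ℕ.* d) · 1# ≈ a · 1# * b · 1# + c · 1# * d · 1#
    sum-of-products·1# a b c d = ≈-trans (×-homo-+ 1# (a ℕ.* b) (c ℕ.* d)) (+-cong (×1-homo-* a b) (×1-homo-* c d))

  open import Algebra.Solver.Ring differenceRing (fromCommutativeRing R) homomorphism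
    (λ d d′ → map (reflexive ∘ cong ⟦_⟧) (dec⇒weaklyDec (Product.≡-dec ℕ._≟_ ℕ._≟_) d d′)) public
    using (Polynomial; con; _:+_; _:*_; _:-_; :-_; solve; _:=_)

module _ {G : Graph} where
  open Graph G

  cycle-vertices-differ : ∀ {m} (C : Cycle G m) (i j : Fin (suc m)) → i ≢ j → Cycle.vert C i ≢ Cycle.vert C j
  cycle-vertices-differ C i j i≢j = i≢j ∘ Cycle.distinct C

  module _ {side : V → Bool} (bipartite : IsBipartiteWrt G side) where

    cycle-sides-alternate : ∀ {m} (C : Cycle G m) → let open Cycle C in
                            ∀ i → side (vert i) ≡ fold (side (vert zero)) not (toℕ i)
    cycle-sides-alternate C = <-weakInduction _ refl step
      where
      open Cycle C
      open ≡-Reasoning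
      step : ∀ i → side (vert (inject₁ i)) ≡ fold (side (vert zero)) not (toℕ (inject₁ i)) →
                   side (vert (suc i)) ≡ fold (side (vert zero)) not (suc (toℕ i))
      step i alternates = begin
        side (vert (suc i))                                   ≡⟨ ¬-not (≢-sym (bipartite _ _ (adjacent i))) ⟩
        not (side (vert (inject₁ i)))                         ≡⟨ cong not alternates ⟩
        not (fold (side (vert zero)) not (toℕ (inject₁ i)))   ≡⟨ cong (not ∘ fold _ not) (toℕ-inject₁ i) ⟩
        not (fold (side (vert zero)) not (toℕ i))             ∎

    bipartite⇒no-odd-cycle : ∀ k → ¬ Cycle G (k ℕ.* 2)
    bipartite⇒no-odd-cycle k C = bipartite _ _ closing (begin
      side (vert (fromℕ (k ℕ.* 2)))                         ≡⟨ cycle-sides-alternate C (fromℕ (k ℕ.* 2)) ⟩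
      fold (side (vert zero)) not (toℕ (fromℕ (k ℕ.* 2)))   ≡⟨ cong (fold _ not) (toℕ-fromℕ (k ℕ.* 2)) ⟩
      fold (side (vert zero)) not (k ℕ.* 2)                 ≡⟨ fold-not-even k ⟩
      side (vert zero)                                      ∎)
      where
      open Cycle C
      open ≡-Reasoning
      fold-not-even : ∀ k {b} → fold b not (k ℕ.* 2) ≡ b
      fold-not-even zero    = refl
      fold-not-even (suc k) = trans (not-involutive _) (fold-not-even k)

Fin^↔Vec : ∀ {m} {A : Set} → Fin m ↔ A → ∀ n → Fin (m ℕ.^ n) ↔ Vec A n
Fin^↔Vec e zero    = mk↔ₛ′ (λ _ → []) (λ _ → zero) (λ { [] → refl }) (λ { zero → refl })
Fin^↔Vec e (suc n) = ↔-trans *↔× (↔-trans (e ×-↔ Fin^↔Vec e n)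
                       (mk↔ₛ′ (uncurry _∷_) uncons (λ { (_ ∷ _) → refl }) (λ _ → refl)))

commutativeRing : Field → CommutativeRing 0ℓ 0ℓ
commutativeRing F = record { isCommutativeRing = Field.isCommutativeRing F }

module Lines (F : Field) (_≟_ : DecidableEquality (Field.Carrier F)) where
  open Field F
  open CommutativeRing (commutativeRing F) using (_-_; +-group; ring; -‿inverseʳ; +-identityˡ; *-identityˡ; zeroʳ)
  open import Algebra.Properties.Group +-group using (x∙y⁻¹≈ε⇒x≈y; x≈y⇒x∙y⁻¹≈ε)
  open import Algebra.Properties.Ring ring using (x[y-z]≈xy-xz)
  open RingSolver (commutativeRing F)
  open ≡-Reasoning

  variable
    a a′ a₁ a₂ a₃ b b′ b₁ b₂ b₃ x x′ x₁ x₂ x₃ y y′ y₁ y₂ y₃ : Carrier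

  x*y≡0⇒x≡0⊎y≡0 : ∀ x y → x * y ≡ 0# → x ≡ 0# ⊎ y ≡ 0#
  x*y≡0⇒x≡0⊎y≡0 x y xy≡0 with x ≟ 0#
  ... | yes x≡0 = inj₁ x≡0
  ... | no  x≢0 = let (x⁻¹ , xx⁻¹≡1) = inverse x x≢0 in inj₂ (begin
    y                ≡⟨ sym (*-identityˡ y) ⟩
    1# * y           ≡⟨ cong (_* y) xx⁻¹≡1 ⟨
    (x * x⁻¹) * y    ≡⟨ solve 3 (λ x x⁻¹ y → (x :* x⁻¹) :* y := x⁻¹ :* (x :* y)) refl x x⁻¹ y ⟩
    x⁻¹ * (x * y)    ≡⟨ cong (x⁻¹ *_) xy≡0 ⟩
    x⁻¹ * 0#         ≡⟨ zeroʳ x⁻¹ ⟩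
    0#               ∎)

  OnLine : (a b x y : Carrier) → Set
  OnLine a b x y = y ≡ a * x + b

  through : ∀ a x y → OnLine a (y - a * x) x y
  through a x y = solve 3 (λ a x y → y := a :* x :+ (y :- a :* x)) refl a x y

  through-unique : OnLine a b x y → b ≡ y - a * x
  through-unique {a} {b} {x} refl = solve 3 (λ a b x → b := (a :* x :+ b) :- a :* x) refl a b x

  intercept-unique : OnLine a b x y → OnLine a b′ x y → b ≡ b′
  intercept-unique on on′ = trans (through-unique on) (sym (through-unique on′))

  meet-equation : OnLine a b x y → OnLine a′ b′ x y → (a - a′) * x ≡ b′ - b
  meet-equation {a} {b} {x} {a′ = a′} {b′} refl on′ = begin
    (a - a′) * x
      ≡⟨ solve 5 (λ a a′ x b b′ → (a :- a′) :* x := ((a :* x :+ b) :- (a′ :* x :+ b′)) :+ (b′ :- b))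
               refl a a′ x b b′ ⟩
    ((a * x + b) - (a′ * x + b′)) + (b′ - b)
      ≡⟨ cong (_+ (b′ - b)) (x≈y⇒x∙y⁻¹≈ε on′) ⟩
    0# + (b′ - b)
      ≡⟨ +-identityˡ (b′ - b) ⟩
    b′ - b
      ∎

  lines-meet-once : OnLine a b x y → OnLine a′ b′ x y → OnLine a b x′ y′ → OnLine a′ b′ x′ y′ →
                    a ≡ a′ ⊎ x ≡ x′
  lines-meet-once {a} {b} {x} {a′ = a′} {b′} {x′} on₁ on₁′ on₂ on₂′ =
    Data.Sum.map (x∙y⁻¹≈ε⇒x≈y a a′) (x∙y⁻¹≈ε⇒x≈y x x′) (x*y≡0⇒x≡0⊎y≡0 (a - a′) (x - x′) (begin
      (a - a′) * (x - x′)               ≡⟨ x[y-z]≈xy-xz (a - a′) x x′ ⟩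
      (a - a′) * x - (a - a′) * x′      ≡⟨ cong₂ _-_ (meet-equation on₁ on₁′) (meet-equation on₂ on₂′) ⟩
      (b′ - b) - (b′ - b)               ≡⟨ -‿inverseʳ (b′ - b) ⟩
      0#                                ∎))

  triangle-sum : (a₁ a₂ a₃ x₁ x₂ x₃ : Carrier) → Carrier
  triangle-sum a₁ a₂ a₃ x₁ x₂ x₃ = (a₁ - a₂) * x₁ + (a₂ - a₃) * x₂ + (a₃ - a₁) * x₃

  -- (xᵢ , yᵢ) is the common point of the lines i and i + 1 (mod 3)
  triangle-relation : OnLine a₁ b₁ x₁ y₁ → OnLine a₂ b₂ x₁ y₁ → OnLine a₂ b₂ x₂ y₂ → OnLine a₃ b₃ x₂ y₂ →
                      OnLine a₃ b₃ x₃ y₃ → OnLine a₁ b₁ x₃ y₃ → triangle-sum a₁ a₂ a₃ x₁ x₂ x₃ ≡ 0#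
  triangle-relation {b₁ = b₁} {b₂ = b₂} {b₃ = b₃} on₁₁ on₂₁ on₂₂ on₃₂ on₃₃ on₁₃ = begin
    _
      ≡⟨ cong₂ _+_ (cong₂ _+_ (meet-equation on₁₁ on₂₁) (meet-equation on₂₂ on₃₂)) (meet-equation on₃₃ on₁₃) ⟩
    (b₂ - b₁) + (b₃ - b₂) + (b₁ - b₃)
      ≡⟨ solve 3 (λ b₁ b₂ b₃ → (b₂ :- b₁) :+ (b₃ :- b₂) :+ (b₁ :- b₃) := con (0 , 0)) refl b₁ b₂ b₃ ⟩
    0#
      ∎

  triangle-sums⇒product≡0 : triangle-sum a₁ a₂ a₃ x₁ x₂ x₃ ≡ 0# →
                               triangle-sum (a₁ * a₁) (a₂ * a₂) (a₃ * a₃) x₁ x₂ x₃ ≡ 0# →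
                               (a₁ - a₂) * (a₂ - a₃) * (x₁ - x₂) ≡ 0#
  triangle-sums⇒product≡0 {a₁} {a₂} {a₃} {x₁} {x₂} {x₃} Σ≡0 Σ²≡0 = begin
    (a₁ - a₂) * (a₂ - a₃) * (x₁ - x₂)
      ≡⟨ solve 6 (λ a₁ a₂ a₃ x₁ x₂ x₃ → (a₁ :- a₂) :* (a₂ :- a₃) :* (x₁ :- x₂) :=
           ((a₁ :* a₁ :- a₂ :* a₂) :* x₁ :+ (a₂ :* a₂ :- a₃ :* a₃) :* x₂ :+ (a₃ :* a₃ :- a₁ :* a₁) :* x₃)
           :- (a₁ :+ a₃) :* ((a₁ :- a₂) :* x₁ :+ (a₂ :- a₃) :* x₂ :+ (a₃ :- a₁) :* x₃))
           refl a₁ a₂ a₃ x₁ x₂ x₃ ⟩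
    triangle-sum (a₁ * a₁) (a₂ * a₂) (a₃ * a₃) x₁ x₂ x₃ - (a₁ + a₃) * triangle-sum a₁ a₂ a₃ x₁ x₂ x₃
      ≡⟨ cong₂ (λ s² s → s² - (a₁ + a₃) * s) Σ²≡0 Σ≡0 ⟩
    0# - (a₁ + a₃) * 0#
      ≡⟨ solve 2 (λ a₁ a₃ → con (0 , 0) :- (a₁ :+ a₃) :* con (0 , 0) := con (0 , 0)) refl a₁ a₃ ⟩
    0#
      ∎

  triangle-sums⇒degenerate : triangle-sum a₁ a₂ a₃ x₁ x₂ x₃ ≡ 0# →
                       triangle-sum (a₁ * a₁) (a₂ * a₂) (a₃ * a₃) x₁ x₂ x₃ ≡ 0# →
                       a₁ ≡ a₂ ⊎ a₂ ≡ a₃ ⊎ x₁ ≡ x₂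
  triangle-sums⇒degenerate {a₁} {a₂} {a₃} {x₁} {x₂} Σ≡0 Σ²≡0 =
    [ Data.Sum.map (x∙y⁻¹≈ε⇒x≈y a₁ a₂) (inj₁ ∘ x∙y⁻¹≈ε⇒x≈y a₂ a₃) ∘ x*y≡0⇒x≡0⊎y≡0 (a₁ - a₂) (a₂ - a₃)
    , inj₂ ∘ inj₂ ∘ x∙y⁻¹≈ε⇒x≈y x₁ x₂
    ]′ (x*y≡0⇒x≡0⊎y≡0 ((a₁ - a₂) * (a₂ - a₃)) (x₁ - x₂) (triangle-sums⇒product≡0 Σ≡0 Σ²≡0))

module Incidence {q : ℕ} (F : FiniteField q) where
  open FiniteField F using (field′; card)
  open Field field′
  open CommutativeRing (commutativeRing field′) using (_-_; -‿inverseʳ; +-group)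
  open import Algebra.Properties.Group +-group using (⁻¹-involutive; ε⁻¹≈ε)
  open Graph (Hq F) using (V; Adj)
  open RingSolver (commutativeRing field′)

  _≟_ : DecidableEquality Carrier
  _≟_ = inj⇒≟ (↔⇒↣ (↔-sym card))

  open Lines field′ _≟_

  point line : Carrier → Carrier → Carrier → V
  point = vtx₀
  line  = vtx₁

  variable
    c c′ c₁ c₂ c₃ z z′ z₁ z₂ z₃ : Carrier

  bipartite : IsBipartiteWrt (Hq F) (part F)
  bipartite (vtx₀ _ _ _) (vtx₀ _ _ _) ()
  bipartite (vtx₀ _ _ _) (vtx₁ _ _ _) _ ()
  bipartite (vtx₁ _ _ _) (vtx₀ _ _ _) _ ()
  bipartite (vtx₁ _ _ _) (vtx₁ _ _ _) ()

  same-slope⇒same-line : a ≡ a′ → Adj (point x y z) (line a b c) → Adj (point x y z) (line a′ b′ c′) →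
                         line a b c ≡ line a′ b′ c′
  same-slope⇒same-line refl (y∈ , z∈) (y∈′ , z∈′) =
    cong₂ (line _) (intercept-unique y∈ y∈′) (intercept-unique z∈ z∈′)

  same-abscissa⇒same-point : x ≡ x′ → Adj (point x y z) (line a b c) → Adj (point x′ y′ z′) (line a b c) →
                             point x y z ≡ point x′ y′ z′
  same-abscissa⇒same-point refl (y∈ , z∈) (y′∈ , z′∈) = cong₂ (point _) (trans y∈ (sym y′∈)) (trans z∈ (sym z′∈))

  at-most-one-common-point :
    Adj (point x y z) (line a b c) → Adj (point x y z) (line a′ b′ c′) →
    Adj (point x′ y′ z′) (line a b c) → Adj (point x′ y′ z′) (line a′ b′ c′) →
    line a b c ≡ line a′ b′ c′ ⊎ point x y z ≡ point x′ y′ z′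
  at-most-one-common-point P∈L P∈L′ P′∈L P′∈L′ =
    Data.Sum.map (λ a≡a′ → same-slope⇒same-line a≡a′ P∈L P∈L′)
                 (λ x≡x′ → same-abscissa⇒same-point x≡x′ P∈L P′∈L)
                 (lines-meet-once (proj₁ P∈L) (proj₁ P∈L′) (proj₁ P′∈L) (proj₁ P′∈L′))

  triangle-degenerate :
    Adj (point x₁ y₁ z₁) (line a₁ b₁ c₁) → Adj (point x₁ y₁ z₁) (line a₂ b₂ c₂) →
    Adj (point x₂ y₂ z₂) (line a₂ b₂ c₂) → Adj (point x₂ y₂ z₂) (line a₃ b₃ c₃) →
    Adj (point x₃ y₃ z₃) (line a₃ b₃ c₃) → Adj (point x₃ y₃ z₃) (line a₁ b₁ c₁) →
    line a₁ b₁ c₁ ≡ line a₂ b₂ c₂ ⊎ line a₂ b₂ c₂ ≡ line a₃ b₃ c₃ ⊎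
    point x₁ y₁ z₁ ≡ point x₂ y₂ z₂
  triangle-degenerate P₁∈L₁ P₁∈L₂ P₂∈L₂ P₂∈L₃ P₃∈L₃ P₃∈L₁ =
    Data.Sum.map (λ a₁≡a₂ → same-slope⇒same-line a₁≡a₂ P₁∈L₁ P₁∈L₂)
      (Data.Sum.map (λ a₂≡a₃ → same-slope⇒same-line a₂≡a₃ P₂∈L₂ P₂∈L₃)
                    (λ x₁≡x₂ → same-abscissa⇒same-point x₁≡x₂ P₁∈L₂ P₂∈L₂))
      (triangle-sums⇒degenerate
        (triangle-relation (proj₁ P₁∈L₁) (proj₁ P₁∈L₂) (proj₁ P₂∈L₂)
                           (proj₁ P₂∈L₃) (proj₁ P₃∈L₃) (proj₁ P₃∈L₁))
        (triangle-relation (proj₂ P₁∈L₁) (proj₂ P₁∈L₂) (proj₂ P₂∈L₂)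
                           (proj₂ P₂∈L₃) (proj₂ P₃∈L₃) (proj₂ P₃∈L₁)))

  data Edge : V → V → Set where
    point-line : Adj (point x y z) (line a b c) → Edge (point x y z) (line a b c)
    line-point : Adj (line a b c) (point x y z) → Edge (line a b c) (point x y z)

  edge : ∀ {v w} → Adj v w → Edge v w
  edge {vtx₀ _ _ _} {vtx₁ _ _ _} e = point-line e
  edge {vtx₁ _ _ _} {vtx₀ _ _ _} e = line-point e
  edge {vtx₀ _ _ _} {vtx₀ _ _ _} ()
  edge {vtx₁ _ _ _} {vtx₁ _ _ _} ()

  no-square : ∀ {v₀ v₁ v₂ v₃} → Edge v₀ v₁ → Edge v₁ v₂ → Edge v₂ v₃ → Edge v₃ v₀ →
              v₀ ≢ v₂ → v₁ ≢ v₃ → ⊥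
  no-square (point-line e₀₁) (line-point e₁₂) (point-line e₂₃) (line-point e₃₀) v₀≢v₂ v₁≢v₃ =
    [ v₁≢v₃ , v₀≢v₂ ]′ (at-most-one-common-point e₀₁ e₃₀ e₁₂ e₂₃)
  no-square (line-point e₀₁) (point-line e₁₂) (line-point e₂₃) (point-line e₃₀) v₀≢v₂ v₁≢v₃ =
    [ v₀≢v₂ , v₁≢v₃ ]′ (at-most-one-common-point e₀₁ e₁₂ e₃₀ e₂₃)

  no-hexagon : ∀ {v₀ v₁ v₂ v₃ v₄ v₅} →
               Edge v₀ v₁ → Edge v₁ v₂ → Edge v₂ v₃ → Edge v₃ v₄ → Edge v₄ v₅ → Edge v₅ v₀ →
               v₀ ≢ v₂ → v₁ ≢ v₃ → v₂ ≢ v₄ → v₃ ≢ v₅ → ⊥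
  no-hexagon (point-line e₀₁) (line-point e₁₂) (point-line e₂₃) (line-point e₃₄) (point-line e₄₅) (line-point e₅₀)
             _ v₁≢v₃ v₂≢v₄ v₃≢v₅ =
    [ v₁≢v₃ , [ v₃≢v₅ , v₂≢v₄ ]′ ]′ (triangle-degenerate e₁₂ e₂₃ e₃₄ e₄₅ e₅₀ e₀₁)
  no-hexagon (line-point e₀₁) (point-line e₁₂) (line-point e₂₃) (point-line e₃₄) (line-point e₄₅) (point-line e₅₀)
             v₀≢v₂ v₁≢v₃ v₂≢v₄ _ =
    [ v₀≢v₂ , [ v₂≢v₄ , v₁≢v₃ ]′ ]′ (triangle-degenerate e₀₁ e₁₂ e₂₃ e₃₄ e₄₅ e₅₀)

  no-4-cycle : ¬ Cycle (Hq F) 3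
  no-4-cycle C = no-square (edge (adjacent 0F)) (edge (adjacent 1F)) (edge (adjacent 2F)) (edge closing)
                           (cycle-vertices-differ C 0F 2F λ ())
                           (cycle-vertices-differ C 1F 3F λ ())
    where open Cycle C

  no-6-cycle : ¬ Cycle (Hq F) 5
  no-6-cycle C = no-hexagon (edge (adjacent 0F)) (edge (adjacent 1F)) (edge (adjacent 2F))
                            (edge (adjacent 3F)) (edge (adjacent 4F)) (edge closing)
                            (cycle-vertices-differ C 0F 2F λ ()) (cycle-vertices-differ C 1F 3F λ ())
                            (cycle-vertices-differ C 2F 4F λ ()) (cycle-vertices-differ C 3F 5F λ ())
    where open Cycle C

  octagon : Fin 8 → V
  octagon 0F = line  0#          0#     0#
  octagon 1F = point 0#          0#     0#
  octagon 2F = line  1#          0#     0#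
  octagon 3F = point 1#          1#     1#
  octagon 4F = line  0#          1#     1#
  octagon 5F = point (1# + 1#)   1#     1#
  octagon 6F = line  1#          (- 1#) (- 1#)
  octagon 7F = point 1#          0#     0#

  0̂ 1̂ : Polynomial 0
  0̂ = con (0 , 0)
  1̂ = con (1 , 0)

  octagon-adjacent : ∀ i → Adj (octagon (inject₁ i)) (octagon (suc i))
  octagon-adjacent 0F = solve 0 (0̂ := 0̂ :* 0̂ :+ 0̂) refl , solve 0 (0̂ := 0̂ :* 0̂ :* 0̂ :+ 0̂) refl
  octagon-adjacent 1F = solve 0 (0̂ := 1̂ :* 0̂ :+ 0̂) refl , solve 0 (0̂ := 1̂ :* 1̂ :* 0̂ :+ 0̂) refl
  octagon-adjacent 2F = solve 0 (1̂ := 1̂ :* 1̂ :+ 0̂) refl , solve 0 (1̂ := 1̂ :* 1̂ :* 1̂ :+ 0̂) refl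
  octagon-adjacent 3F = solve 0 (1̂ := 0̂ :* 1̂ :+ 1̂) refl , solve 0 (1̂ := 0̂ :* 0̂ :* 1̂ :+ 1̂) refl
  octagon-adjacent 4F = solve 0 (1̂ := 0̂ :* (1̂ :+ 1̂) :+ 1̂) refl , solve 0 (1̂ := 0̂ :* 0̂ :* (1̂ :+ 1̂) :+ 1̂) refl
  octagon-adjacent 5F = solve 0 (1̂ := 1̂ :* (1̂ :+ 1̂) :+ :- 1̂) refl , solve 0 (1̂ := 1̂ :* 1̂ :* (1̂ :+ 1̂) :+ :- 1̂) refl
  octagon-adjacent 6F = solve 0 (0̂ := 1̂ :* 1̂ :+ :- 1̂) refl , solve 0 (0̂ := 1̂ :* 1̂ :* 1̂ :+ :- 1̂) refl

  octagon-closing : Adj (octagon 7F) (octagon 0F)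
  octagon-closing = solve 0 (0̂ := 0̂ :* 1̂ :+ 0̂) refl , solve 0 (0̂ := 0̂ :* 0̂ :* 1̂ :+ 0̂) refl

  isZero : Carrier → Bool
  isZero x = does (x ≟ 0#)

  isZero-true : x ≡ 0# → isZero x ≡ true
  isZero-true {x} = dec-true (x ≟ 0#)

  isZero-false : x ≢ 0# → isZero x ≡ false
  isZero-false {x} = dec-false (x ≟ 0#)

  1≢0 : 1# ≢ 0#
  1≢0 = 0≢1 ∘ sym

  -1≢0 : - 1# ≢ 0#
  -1≢0 -1≡0 = 1≢0 (trans (sym (⁻¹-involutive 1#)) (trans (cong -_ -1≡0) ε⁻¹≈ε))

  line-index point-index : Bool → Bool → Fin 8
  line-index  true  true  = 0F
  line-index  false true  = 2F
  line-index  true  false = 4F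
  line-index  false false = 6F
  point-index true  true  = 1F
  point-index false true  = 3F
  point-index false false = 5F
  point-index true  false = 7F

  -- A left inverse of octagon; it only asks which coordinates vanish, so that it works in every
  -- characteristic (in characteristic 2, the abscissa 1# + 1# of octagon 5F is 0#).
  octagon-index : V → Fin 8
  octagon-index (vtx₁ a b _) = line-index (isZero a) (isZero b)
  octagon-index (vtx₀ x y _) = point-index (isZero y) (isZero (x - y))

  octagon-index-octagon : ∀ i → octagon-index (octagon i) ≡ i
  octagon-index-octagon 0F = cong₂ line-index  (isZero-true refl) (isZero-true refl)
  octagon-index-octagon 1F = cong₂ point-index (isZero-true refl) (isZero-true (-‿inverseʳ 0#))
  octagon-index-octagon 2F = cong₂ line-index  (isZero-false 1≢0) (isZero-true refl)
  octagon-index-octagon 3F = cong₂ point-index (isZero-false 1≢0) (isZero-true (-‿inverseʳ 1#))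
  octagon-index-octagon 4F = cong₂ line-index  (isZero-true refl) (isZero-false 1≢0)
  octagon-index-octagon 5F = cong₂ point-index (isZero-false 1≢0) (isZero-false (1≢0 ∘ trans (sym [1+1]-1≡1)))
    where
    [1+1]-1≡1 : (1# + 1#) - 1# ≡ 1#
    [1+1]-1≡1 = solve 0 ((1̂ :+ 1̂) :- 1̂ := 1̂) refl
  octagon-index-octagon 6F = cong₂ line-index  (isZero-false 1≢0) (isZero-false -1≢0)
  octagon-index-octagon 7F = cong₂ point-index (isZero-true refl) (isZero-false (1≢0 ∘ trans (sym 1-0≡1)))
    where
    1-0≡1 : 1# - 0# ≡ 1#
    1-0≡1 = solve 0 (1̂ :- 0̂ := 1̂) refl

  octagon-cycle : Cycle (Hq F) 7
  octagon-cycle = record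
    { vert     = octagon
    ; distinct = λ {i} {j} eq → trans (sym (octagon-index-octagon i)) (trans (cong octagon-index eq) (octagon-index-octagon j))
    ; adjacent = octagon-adjacent
    ; closing  = octagon-closing
    }

  no-short-cycle : ∀ n → n < 8 → ¬ HasCycleOfLength (Hq F) n
  no-short-cycle 0 _ ()
  no-short-cycle 1 _ (s≤s () , _)
  no-short-cycle 2 _ (s≤s (s≤s ()) , _)
  no-short-cycle 3 _ (_ , C) = bipartite⇒no-odd-cycle bipartite 1 C
  no-short-cycle 4 _ (_ , C) = no-4-cycle C
  no-short-cycle 5 _ (_ , C) = bipartite⇒no-odd-cycle bipartite 2 C
  no-short-cycle 6 _ (_ , C) = no-6-cycle C
  no-short-cycle 7 _ (_ , C) = bipartite⇒no-odd-cycle bipartite 3 C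
  no-short-cycle (suc (suc (suc (suc (suc (suc (suc (suc _))))))))
                 (s≤s (s≤s (s≤s (s≤s (s≤s (s≤s (s≤s (s≤s ())))))))) _

  girth-8 : HasGirth (Hq F) 8
  girth-8 = (s≤s (s≤s (s≤s z≤n)) , octagon-cycle) , no-short-cycle

  open Decidable⇒UIP _≟_ using (≡-irrelevant)

  adjacency-irrelevant : ∀ {v w} (e e′ : Adj v w) → e ≡ e′
  adjacency-irrelevant {vtx₀ _ _ _} {vtx₁ _ _ _} (p , q) (p′ , q′) =
    cong₂ _,_ (≡-irrelevant p p′) (≡-irrelevant q q′)
  adjacency-irrelevant {vtx₁ _ _ _} {vtx₀ _ _ _} (p , q) (p′ , q′) =
    cong₂ _,_ (≡-irrelevant p p′) (≡-irrelevant q q′)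

  neighbour-≡ : ∀ {v w w′} {e : Adj v w} {e′ : Adj v w′} → w ≡ w′ → (w , e) ≡ (w′ , e′)
  neighbour-≡ refl = cong (_ ,_) (adjacency-irrelevant _ _)

  neighbourhood : ∀ v → Carrier ↔ Σ V (Adj v)
  neighbourhood (vtx₁ a b c) = mk↔ₛ′ (λ x → point x (a * x + b) (a * a * x + c) , refl , refl) abscissa
    (λ { (vtx₀ _ _ _ , refl , refl) → refl ; (vtx₁ _ _ _ , ()) }) (λ _ → refl)
    where
    abscissa : Σ V (Adj (line a b c)) → Carrier
    abscissa (vtx₀ x _ _ , _)  = x
    abscissa (vtx₁ _ _ _ , ())
  neighbourhood (vtx₀ x y z) =
    mk↔ₛ′ (λ a → line a (y - a * x) (z - a * a * x) , through a x y , through (a * a) x z) slope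
    (λ { (vtx₁ a _ _ , y∈ , z∈) → neighbour-≡ (cong₂ (line a) (sym (through-unique y∈)) (sym (through-unique z∈)))
       ; (vtx₀ _ _ _ , ()) })
    (λ _ → refl)
    where
    slope : Σ V (Adj (point x y z)) → Carrier
    slope (vtx₁ a _ _ , _)  = a
    slope (vtx₀ _ _ _ , ())

  regular : IsRegular (Hq F) q
  regular v = ↔-trans card (neighbourhood v)

  vertex-encoding : (Bool × Vec Carrier 3) ↔ V
  vertex-encoding = mk↔ₛ′ decode encode decode-encode encode-decode
    where
    decode : Bool × Vec Carrier 3 → V
    decode (false , x ∷ y ∷ z ∷ []) = point x y z
    decode (true  , a ∷ b ∷ c ∷ []) = line a b c
    encode : V → Bool × Vec Carrier 3
    encode (vtx₀ x y z) = false , x ∷ y ∷ z ∷ []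
    encode (vtx₁ a b c) = true  , a ∷ b ∷ c ∷ []
    decode-encode : ∀ v → decode (encode v) ≡ v
    decode-encode (vtx₀ _ _ _) = refl
    decode-encode (vtx₁ _ _ _) = refl
    encode-decode : ∀ s → encode (decode s) ≡ s
    encode-decode (false , _ ∷ _ ∷ _ ∷ []) = refl
    encode-decode (true  , _ ∷ _ ∷ _ ∷ []) = refl

  order : HasOrder (Hq F) (2 ℕ.* q ℕ.^ 3)
  order = ↔-trans *↔× (↔-trans (2↔Bool ×-↔ Fin^↔Vec card 3) vertex-encoding)

open import Data.Nat using (_*_; _^_)

proposition1 : (q : ℕ) → 2 ≤ q → IsPrimePower q → (F : FiniteField q) →
    IsBipartiteWrt (Hq F) (part F) × IsRegular (Hq F) q ×
    HasGirth (Hq F) 8 × HasOrder (Hq F) (2 * q ^ 3)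
proposition1 q _ _ F = bipartite , regular , girth-8 , order
  where
  open Incidence F
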